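{- Let $k, m \geq 2$ be integers, let $h$ be an $m$-uniform morphism on a finite alphabet $\Sigma$ (i.e. $|h(a)| = m$ for every $a \in \Sigma$), and let $w \in \Sigma^\omega$ be a fixed point of $h$. Let $i \ge 0$ be an integer such that $m^i \geq k - 1$. Then $\mathcal P^{(k)}_w(m^i (n + 1)) = O(\mathcal P^{(2)}_w(n))$ as $n \to \infty$.
   Context: For a finite word $u$ and a nonempty word $x$, $|u|_x$ denotes the number of occurrences of $x$ as a factor of $u$. Two finite words $u, v$ are $k$-Abelian equivalent if $|u|_x = |v|_x$ for all nonempty words $x$ of length at most $k$. For an infinite word $w$, $\mathcal P^{(k)}_w(n)$ is the number of $k$-Abelian equivalence classes among the factors of $w$ of length $n$. -}

module Defs where

open import Data.Nat using (ℕ; zero; suc; _+_; _*_; _≤_)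
open import Data.Fin using (Fin; toℕ)
import Data.Fin.Properties as FinP
open import Data.List using (List; []; _∷_; length; take; map; upTo)
import Data.List.Properties as ListP
open import Data.Vec using (Vec; lookup)
open import Data.Product using (Σ; ∃; _×_)
open import Data.Bool using (if_then_else_)
open import Relation.Nullary using (does)
open import Relation.Binary.PropositionalEquality using (_≡_)

UniformMorphism : ℕ → ℕ → Set
UniformMorphism s m = Fin s → Vec (Fin s) m

-- w is a fixed point of the m-uniform morphism h, i.e. h(w) = w:
-- the letter at position q*m + r of h(w) is the r-th letter of h(w q).
IsFixedPoint : ∀ {s m} → UniformMorphism s m → (ℕ → Fin s) → Set
IsFixedPoint {s} {m} h w = ∀ (q : ℕ) (r : Fin m) → w (q * m + toℕ r) ≡ lookup (h (w q)) r

-- |u|_x : number of occurrences of x as a factor of u (intended for nonempty x).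
occ : ∀ {s} → List (Fin s) → List (Fin s) → ℕ
occ x [] = 0
occ x (a ∷ u) =
  (if does (ListP.≡-dec FinP._≟_ (take (length x) (a ∷ u)) x) then 1 else 0) + occ x u

KAbelianEq : ∀ {s} → ℕ → List (Fin s) → List (Fin s) → Set
KAbelianEq {s} k u v = ∀ (x : List (Fin s)) → 1 ≤ length x → length x ≤ k → occ x u ≡ occ x v

factor : ∀ {s} → (ℕ → Fin s) → ℕ → ℕ → List (Fin s)
factor w p n = map (λ j → w (p + j)) (upTo n)

-- "𝒫^(k)_w(n) = N": there are N length-n factors of w (given by starting positions),
-- pairwise not k-Abelian equivalent, such that every length-n factor is
-- k-Abelian equivalent to one of them; i.e. N is the number of classes.
AbelianComplexityIs : ∀ {s} → ℕ → (ℕ → Fin s) → ℕ → ℕ → Set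
AbelianComplexityIs k w n N =
  Σ (Fin N → ℕ) λ ps →
    (∀ i j → KAbelianEq k (factor w (ps i) n) (factor w (ps j) n) → i ≡ j) ×
    (∀ p → ∃ λ i → KAbelianEq k (factor w p n) (factor w (ps i) n))

-- Put M = m ^ i.  Since w is also a fixed point of the M-uniform morphism hⁱ,
-- w is the concatenation of the blocks hⁱ(w t), t ≥ 0, of length M.  As every x
-- with |x| ≤ k has |x| - 1 ≤ M, each occurrence of x lies inside two
-- consecutive blocks.  So in a factor of length M (n + 1) starting at q M + r,
-- |·|_x is the count over the two blocks q, q + 1 (a function of r, w q,
-- w (q + 1)), plus Σ β(w t, w (t + 1)) over the consecutive pairs of the
-- length-n factor of w at q + 1, which is Σ_{a,b} β(a, b) |·|_ab and hence
-- depends only on its 2-Abelian class, plus the count over the two blocks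
-- q + n, q + n + 1.  Thus r, four letters and a 2-Abelian class of length-n
-- factors determine the k-Abelian class, and 𝒫⁽ᵏ⁾(M (n + 1)) ≤ M s⁴ 𝒫⁽²⁾(n).

module Submission where

open import Defs
open import Data.Nat using (ℕ; zero; suc; _+_; _*_; _^_; _∸_; _≤_; _<_; z≤n; s≤s; NonZero)
open import Data.Nat.Properties
open import Data.Nat.DivMod using (_divMod_; module DivMod)
open import Data.Nat.Tactic.RingSolver using (solve-∀)
open import Data.Fin using (Fin; toℕ; combine; remQuot; punchIn) renaming (zero to fzero; suc to fsuc)
import Data.Fin.Properties as FinP
open import Data.List using (List; []; _∷_; _++_; length; take; drop; applyUpTo)
import Data.List.Properties as ListP
open import Data.Vec using (Vec; lookup; toList; concat) renaming ([] to []ᵥ; _∷_ to _∷ᵥ_; map to mapᵥ)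
import Data.Vec.Properties as VecP
open import Data.Product using (∃₂; _,_; proj₁; proj₂)
open import Data.Bool using (if_then_else_)
open import Function using (_∘_)
open import Relation.Nullary using (does)
open import Relation.Nullary.Decidable using (dec-true; dec-false)
open import Relation.Binary.PropositionalEquality
open import Algebra.Properties.Semiring.Sum +-*-semiring
  using (sum; ∑-distrib-+; sum-cong-≗; sum-remove; sum-replicate-zero)

open ≡-Reasoning

private
  variable
    A B : Set
    s : ℕ

window : (ℕ → A) → ℕ → ℕ → List A
window w p zero    = []
window w p (suc n) = w p ∷ window w (suc p) n

length-window : ∀ (w : ℕ → A) p n → length (window w p n) ≡ n
length-window w p zero    = refl
length-window w p (suc n) = cong suc (length-window w (suc p) n)

window-++ : ∀ (w : ℕ → A) p m n → window w p (m + n) ≡ window w p m ++ window w (p + m) n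
window-++ w p zero    n = cong (λ q → window w q n) (sym (+-identityʳ p))
window-++ w p (suc m) n = cong (w p ∷_) (trans (window-++ w (suc p) m n)
  (cong (λ q → window w (suc p) m ++ window w q n) (sym (+-suc p m))))

take-window : ∀ (w : ℕ → A) p {l n} → l ≤ n → take l (window w p n) ≡ window w p l
take-window w p z≤n       = refl
take-window w p (s≤s l≤n) = cong (w p ∷_) (take-window w (suc p) l≤n)

take-drop-window : ∀ (w : ℕ → A) p c {l n} → c + l ≤ n →
  take l (drop c (window w p n)) ≡ window w (p + c) l
take-drop-window w p zero    {l} l≤n = trans (take-window w p l≤n) (cong (λ q → window w q l) (sym (+-identityʳ p)))
take-drop-window w p (suc c) {l} {suc n} (s≤s c+l≤n) =
  trans (take-drop-window w (suc p) c c+l≤n) (cong (λ q → window w q l) (sym (+-suc p c)))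

applyUpTo≡window : ∀ (w : ℕ → A) p n (f : ℕ → A) → (∀ j → f j ≡ w (p + j)) → applyUpTo f n ≡ window w p n
applyUpTo≡window w p zero    f f≗ = refl
applyUpTo≡window w p (suc n) f f≗ = cong₂ _∷_ (trans (f≗ 0) (cong w (+-identityʳ p)))
  (applyUpTo≡window w (suc p) n (f ∘ suc) (λ j → trans (f≗ (suc j)) (cong w (+-suc p j))))

factor≡window : ∀ (w : ℕ → Fin s) p n → factor w p n ≡ window w p n
factor≡window w p n = trans (ListP.map-applyUpTo (λ j → j) (λ j → w (p + j)) n)
  (applyUpTo≡window w p n (λ j → w (p + j)) (λ j → refl))

window≡toList : ∀ (w : ℕ → A) p {n} (v : Vec A n) → (∀ r → w (p + toℕ r) ≡ lookup v r) →
  window w p n ≡ toList v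
window≡toList w p []ᵥ       _ = refl
window≡toList w p (x ∷ᵥ v) w≗v = cong₂ _∷_ (trans (cong w (sym (+-identityʳ p))) (w≗v fzero))
  (window≡toList w (suc p) v (λ r → trans (cong w (sym (+-suc p (toℕ r)))) (w≗v (fsuc r))))

δ : List (Fin s) → List (Fin s) → ℕ
δ x y = if does (ListP.≡-dec FinP._≟_ y x) then 1 else 0

δ-refl : ∀ (x : List (Fin s)) → δ x x ≡ 1
δ-refl x rewrite dec-true (ListP.≡-dec FinP._≟_ x x) refl = refl

δ-≢ : ∀ {x y : List (Fin s)} → y ≢ x → δ x y ≡ 0
δ-≢ {x = x} {y} y≢x rewrite dec-false (ListP.≡-dec FinP._≟_ y x) y≢x = refl

occ-short : ∀ (x u : List (Fin s)) → length u < length x → occ x u ≡ 0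
occ-short x []      _ = refl
occ-short x (c ∷ u) u<x = cong₂ _+_
  (trans (cong (δ x) (ListP.take-all (length x) (c ∷ u) (<⇒≤ u<x)))
         (δ-≢ {x = x} (λ u≡x → <-irrefl (cong length u≡x) u<x)))
  (occ-short x u (<-trans (n<1+n (length u)) u<x))

take-++-take : ∀ {m} n (u v : List A) → n ≤ m → take n (u ++ v) ≡ take n (u ++ take m v)
take-++-take zero    u       v       _        = refl
take-++-take (suc n) []      []      _        = cong (take (suc n)) (sym (ListP.take-[] _))
take-++-take (suc n) []      (y ∷ v) (s≤s n≤m) = cong (y ∷_) (take-++-take n [] v n≤m)
take-++-take (suc n) (x ∷ u) v       n<m      = cong (x ∷_) (take-++-take n u v (<⇒≤ n<m))

-- An occurrence of a ∷ x' in u ++ v either starts inside u, and then lies in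
-- u ++ take (length x') v, or it starts inside v.
occ-++ : ∀ (a : Fin s) x' (u v : List (Fin s)) →
  occ (a ∷ x') (u ++ v) ≡ occ (a ∷ x') (u ++ take (length x') v) + occ (a ∷ x') v
occ-++ a x' []      v = cong (_+ occ (a ∷ x') v) (sym (occ-short (a ∷ x') (take (length x') v)
  (s≤s (≤-trans (≤-reflexive (ListP.length-take (length x') v)) (m⊓n≤m _ _)))))
occ-++ a x' (c ∷ u) v = trans
  (cong₂ _+_ (cong (δ (a ∷ x') ∘ (c ∷_)) (take-++-take (length x') u v ≤-refl)) (occ-++ a x' u v))
  (sym (+-assoc (δ (a ∷ x') (c ∷ take (length x') (u ++ take (length x') v))) _ _))

occ-window-split : ∀ (a : Fin s) x' (w : ℕ → Fin s) p m n → length x' ≤ n →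
  occ (a ∷ x') (window w p (m + n)) ≡
  occ (a ∷ x') (window w p (m + length x')) + occ (a ∷ x') (window w (p + m) n)
occ-window-split {s = s} a x' w p m n x'≤n = begin
  occ x (window w p (m + n))
    ≡⟨ cong (occ x) (window-++ w p m n) ⟩
  occ x (window w p m ++ window w (p + m) n)
    ≡⟨ occ-++ a x' (window w p m) (window w (p + m) n) ⟩
  occ x (window w p m ++ take ℓ' (window w (p + m) n)) + occ x (window w (p + m) n)
    ≡⟨ cong (λ u → occ x (window w p m ++ u) + occ x (window w (p + m) n)) (take-window w (p + m) x'≤n) ⟩
  occ x (window w p m ++ window w (p + m) ℓ') + occ x (window w (p + m) n)
    ≡⟨ cong (λ u → occ x u + occ x (window w (p + m) n)) (window-++ w p m ℓ') ⟨
  occ x (window w p (m + ℓ')) + occ x (window w (p + m) n) ∎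
  where
    x : List (Fin s)
    x = a ∷ x'
    ℓ' : ℕ
    ℓ' = length x'

pairsum : (A → A → ℕ) → List A → ℕ
pairsum β (a ∷ b ∷ u) = β a b + pairsum β (b ∷ u)
pairsum β _           = 0

occ-window-blocks : ∀ (a : Fin s) x' (w : ℕ → Fin s) M (v : ℕ → B) (β : B → B → ℕ) →
  (∀ t → occ (a ∷ x') (window w (t * M) (M + length x')) ≡ β (v t) (v (suc t))) →
  ∀ t n → occ (a ∷ x') (window w (t * M) (n * M + length x')) ≡ pairsum β (window v t (suc n))
occ-window-blocks a x' w M v β block≡β t zero =
  occ-short (a ∷ x') (window w (t * M) (length x')) (s≤s (≤-reflexive (length-window w (t * M) (length x'))))
occ-window-blocks {s = s} a x' w M v β block≡β t (suc n) = begin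
  occ x (window w (t * M) ((M + n * M) + ℓ'))
    ≡⟨ cong (occ x ∘ window w (t * M)) (+-assoc M (n * M) ℓ') ⟩
  occ x (window w (t * M) (M + (n * M + ℓ')))
    ≡⟨ occ-window-split a x' w (t * M) M (n * M + ℓ') (m≤n+m ℓ' (n * M)) ⟩
  occ x (window w (t * M) (M + ℓ')) + occ x (window w (t * M + M) (n * M + ℓ'))
    ≡⟨ cong₂ _+_ (block≡β t) (cong (λ p → occ x (window w p (n * M + ℓ'))) (+-comm (t * M) M)) ⟩
  β (v t) (v (suc t)) + occ x (window w (suc t * M) (n * M + ℓ'))
    ≡⟨ cong (β (v t) (v (suc t)) +_) (occ-window-blocks a x' w M v β block≡β (suc t) n) ⟩
  β (v t) (v (suc t)) + pairsum β (window v (suc t) (suc n)) ∎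
  where
    x : List (Fin s)
    x = a ∷ x'
    ℓ' : ℕ
    ℓ' = length x'

∑-zero : ∀ {n} (f : Fin n → ℕ) → (∀ a → f a ≡ 0) → sum f ≡ 0
∑-zero {n} f f≗0 = trans (sum-cong-≗ f≗0) (sum-replicate-zero n)

∑-point : ∀ {n} (f : Fin n → ℕ) c → (∀ a → a ≢ c → f a ≡ 0) → sum f ≡ f c
∑-point {suc n} f c vanishes = begin
  sum f                                   ≡⟨ sum-remove {i = c} f ⟩
  f c + sum (λ j → f (punchIn c j))       ≡⟨ cong (f c +_) (∑-zero _ (λ j → vanishes _ (FinP.punchInᵢ≢i c j))) ⟩
  f c + 0                                 ≡⟨ +-identityʳ (f c) ⟩
  f c                                     ∎

∑∑-occ-short : ∀ (β : Fin s → Fin s → ℕ) u → length u < 2 →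
  sum (λ a → sum (λ b → β a b * occ (a ∷ b ∷ []) u)) ≡ 0
∑∑-occ-short β u u<2 = ∑-zero _ (λ a → ∑-zero _ (λ b →
  trans (cong (β a b *_) (occ-short (a ∷ b ∷ []) u u<2)) (*-zeroʳ (β a b))))

pairsum≡∑ : ∀ (β : Fin s → Fin s → ℕ) u →
  pairsum β u ≡ sum (λ a → sum (λ b → β a b * occ (a ∷ b ∷ []) u))
pairsum≡∑ β []          = sym (∑∑-occ-short β [] (s≤s z≤n))
pairsum≡∑ β (c ∷ [])    = sym (∑∑-occ-short β (c ∷ []) (s≤s (s≤s z≤n)))
pairsum≡∑ β (c ∷ d ∷ u) = sym (begin
  sum (λ a → sum (λ b → β a b * (δ (a ∷ b ∷ []) (c ∷ d ∷ []) + occ (a ∷ b ∷ []) (d ∷ u))))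
    ≡⟨ sum-cong-≗ (λ a → trans (sum-cong-≗ (λ b → *-distribˡ-+ (β a b) _ _)) (∑-distrib-+ (βδ a) (βocc a))) ⟩
  sum (λ a → sum (βδ a) + sum (βocc a))
    ≡⟨ ∑-distrib-+ (sum ∘ βδ) (sum ∘ βocc) ⟩
  sum (λ a → sum (βδ a)) + sum (λ a → sum (βocc a))
    ≡⟨ cong₂ _+_ ∑∑-δ (sym (pairsum≡∑ β (d ∷ u))) ⟩
  β c d + pairsum β (d ∷ u) ∎)
  where
    βδ βocc : Fin _ → Fin _ → ℕ
    βδ a b = β a b * δ (a ∷ b ∷ []) (c ∷ d ∷ [])
    βocc a b = β a b * occ (a ∷ b ∷ []) (d ∷ u)
    off-diagonal : ∀ a b → c ∷ d ∷ [] ≢ a ∷ b ∷ [] → βδ a b ≡ 0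
    off-diagonal a b cd≢ab = trans (cong (β a b *_) (δ-≢ cd≢ab)) (*-zeroʳ (β a b))
    ∑∑-δ : sum (λ a → sum (βδ a)) ≡ β c d
    ∑∑-δ = begin
      sum (λ a → sum (βδ a))
        ≡⟨ ∑-point _ c (λ a a≢c → ∑-zero _ (λ b → off-diagonal a b (λ { refl → a≢c refl }))) ⟩
      sum (βδ c)
        ≡⟨ ∑-point _ d (λ b b≢d → off-diagonal c b (λ { refl → b≢d refl })) ⟩
      β c d * δ (c ∷ d ∷ []) (c ∷ d ∷ [])
        ≡⟨ cong (β c d *_) (δ-refl (c ∷ d ∷ [])) ⟩
      β c d * 1
        ≡⟨ *-identityʳ (β c d) ⟩
      β c d ∎

pairsum-cong-2Abelian : ∀ (β : Fin s → Fin s → ℕ) {u v} → KAbelianEq 2 u v → pairsum β u ≡ pairsum β v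
pairsum-cong-2Abelian β {u} {v} u≈v = begin
  pairsum β u                                                ≡⟨ pairsum≡∑ β u ⟩
  sum (λ a → sum (λ b → β a b * occ (a ∷ b ∷ []) u))
    ≡⟨ sum-cong-≗ (λ a → sum-cong-≗ (λ b → cong (β a b *_) (u≈v (a ∷ b ∷ []) (s≤s z≤n) ≤-refl))) ⟩
  sum (λ a → sum (λ b → β a b * occ (a ∷ b ∷ []) v))         ≡⟨ pairsum≡∑ β v ⟨
  pairsum β v                                                ∎

iterate : ∀ {m} → UniformMorphism s m → (i : ℕ) → UniformMorphism s (m ^ i)
iterate h zero    a = a ∷ᵥ []ᵥ
iterate h (suc i) a = concat (mapᵥ (iterate h i) (h a))

iterate-fixedPoint : ∀ {m} {h : UniformMorphism s m} {w} → IsFixedPoint h w → ∀ i → IsFixedPoint (iterate h i) w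
iterate-fixedPoint {w = w} fixed zero q fzero = cong w (trans (+-identityʳ (q * 1)) (*-identityʳ q))
iterate-fixedPoint {m = m} {h} {w} fixed (suc i) q r =
  subst (λ r → w (q * (m * M) + toℕ r) ≡ lookup (iterate h (suc i) (w q)) r)
        (FinP.combine-remQuot {m} M r) (at-combine (proj₁ (remQuot {m} M r)) (proj₂ (remQuot {m} M r)))
  where
    M : ℕ
    M = m ^ i
    position : ∀ q m M j r → q * (m * M) + (M * j + r) ≡ (q * m + j) * M + r
    position = solve-∀
    at-combine : ∀ j r → w (q * (m * M) + toℕ (combine j r)) ≡ lookup (iterate h (suc i) (w q)) (combine j r)
    at-combine j r = begin
      w (q * (m * M) + toℕ (combine j r))               ≡⟨ cong (λ t → w (q * (m * M) + t)) (FinP.toℕ-combine j r) ⟩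
      w (q * (m * M) + (M * toℕ j + toℕ r))             ≡⟨ cong w (position q m M (toℕ j) (toℕ r)) ⟩
      w ((q * m + toℕ j) * M + toℕ r)                   ≡⟨ iterate-fixedPoint fixed i (q * m + toℕ j) r ⟩
      lookup (iterate h i (w (q * m + toℕ j))) r        ≡⟨ cong (λ a → lookup (iterate h i a) r) (fixed q j) ⟩
      lookup (iterate h i (lookup (h (w q)) j)) r       ≡⟨ cong (λ v → lookup v r) (VecP.lookup-map j (iterate h i) (h (w q))) ⟨
      lookup (lookup (mapᵥ (iterate h i) (h (w q))) j) r ≡⟨ VecP.lookup-concat (mapᵥ (iterate h i) (h (w q))) j r ⟨
      lookup (iterate h (suc i) (w q)) (combine j r)    ∎

occ-window-head-middle-tail : ∀ (a : Fin s) x' (w : ℕ → Fin s) M q r n' → r ≤ M → length x' ≤ M →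
  occ (a ∷ x') (window w (q * M + r) (M * suc (suc n'))) ≡
    occ (a ∷ x') (window w (q * M + r) (M ∸ r + length x')) +
    (occ (a ∷ x') (window w (suc q * M) (n' * M + length x')) +
     occ (a ∷ x') (window w ((suc q + n') * M) (r + M)))
occ-window-head-middle-tail {s = s} a x' w M q r n' r≤M x'≤M = begin
  occ x (window w p (M * suc (suc n')))
    ≡⟨ cong (occ x ∘ window w p) length-split ⟩
  occ x (window w p (M ∸ r + (n' * M + (r + M))))
    ≡⟨ occ-window-split a x' w p (M ∸ r) (n' * M + (r + M))
         (≤-trans x'≤M (≤-trans (m≤n+m M r) (m≤n+m (r + M) (n' * M)))) ⟩
  head + occ x (window w (p + (M ∸ r)) (n' * M + (r + M)))
    ≡⟨ cong (λ t → head + occ x (window w t (n' * M + (r + M)))) next-block ⟩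
  head + occ x (window w (suc q * M) (n' * M + (r + M)))
    ≡⟨ cong (head +_) (occ-window-split a x' w (suc q * M) (n' * M) (r + M) (≤-trans x'≤M (m≤n+m M r))) ⟩
  head + (middle + occ x (window w (suc q * M + n' * M) (r + M)))
    ≡⟨ cong (λ t → head + (middle + occ x (window w t (r + M)))) (*-distribʳ-+ M (suc q) n') ⟨
  head + (middle + occ x (window w ((suc q + n') * M) (r + M))) ∎
  where
    x : List (Fin s)
    x = a ∷ x'
    p : ℕ
    p = q * M + r
    head : ℕ
    head = occ x (window w p (M ∸ r + length x'))
    middle : ℕ
    middle = occ x (window w (suc q * M) (n' * M + length x'))
    unfold : ∀ M n' → M * suc (suc n') ≡ M + (n' * M + M)
    unfold = solve-∀
    regroup : ∀ d r t M → (d + r) + (t + M) ≡ d + (t + (r + M))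
    regroup = solve-∀
    length-split : M * suc (suc n') ≡ M ∸ r + (n' * M + (r + M))
    length-split = begin
      M * suc (suc n')              ≡⟨ unfold M n' ⟩
      M + (n' * M + M)              ≡⟨ cong (_+ (n' * M + M)) (m∸n+n≡m r≤M) ⟨
      (M ∸ r + r) + (n' * M + M)    ≡⟨ regroup (M ∸ r) r (n' * M) M ⟩
      M ∸ r + (n' * M + (r + M))    ∎
    next-block : p + (M ∸ r) ≡ suc q * M
    next-block = begin
      q * M + r + (M ∸ r)           ≡⟨ +-assoc (q * M) r (M ∸ r) ⟩
      q * M + (r + (M ∸ r))         ≡⟨ cong (q * M +_) (m+[n∸m]≡n r≤M) ⟩
      q * M + M                     ≡⟨ +-comm (q * M) M ⟩
      suc q * M                     ∎

module Blocks {M : ℕ} (g : UniformMorphism s M) (w : ℕ → Fin s) (fixed : IsFixedPoint g w) where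

  block : Fin s → List (Fin s)
  block a = toList (g a)

  window-twoBlocks : ∀ q → window w (q * M) (M + M) ≡ block (w q) ++ block (w (suc q))
  window-twoBlocks q = begin
    window w (q * M) (M + M)                       ≡⟨ window-++ w (q * M) M M ⟩
    window w (q * M) M ++ window w (q * M + M) M   ≡⟨ cong (λ t → window w (q * M) M ++ window w t M) (+-comm (q * M) M) ⟩
    window w (q * M) M ++ window w (suc q * M) M   ≡⟨ cong₂ _++_ (window≡toList w _ (g (w q)) (fixed q))
                                                                (window≡toList w _ (g (w (suc q))) (fixed (suc q))) ⟩
    block (w q) ++ block (w (suc q))               ∎

  window-prefix-twoBlocks : ∀ q {l} → l ≤ M + M → window w (q * M) l ≡ take l (block (w q) ++ block (w (suc q)))
  window-prefix-twoBlocks q l≤2M = trans (sym (take-window w (q * M) l≤2M)) (cong (take _) (window-twoBlocks q))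

  window-inside-twoBlocks : ∀ q c {l} → c + l ≤ M + M →
    window w (q * M + c) l ≡ take l (drop c (block (w q) ++ block (w (suc q))))
  window-inside-twoBlocks q c c+l≤2M =
    trans (sym (take-drop-window w (q * M) c c+l≤2M)) (cong (take _ ∘ drop c) (window-twoBlocks q))

  module Count (a : Fin s) (x' : List (Fin s)) (x'≤M : length x' ≤ M) where

    x : List (Fin s)
    x = a ∷ x'
    ℓ' : ℕ
    ℓ' = length x'

    β : Fin s → Fin s → ℕ
    β c d = occ x (take (M + ℓ') (block c ++ block d))

    headCount : ℕ → Fin s → Fin s → ℕ
    headCount r c₀ c₁ = occ x (take (M ∸ r + ℓ') (drop r (block c₀ ++ block c₁)))

    tailCount : ℕ → Fin s → Fin s → ℕ
    tailCount r d₀ d₁ = occ x (take (r + M) (block d₀ ++ block d₁))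

    occ-by-blocks : ∀ q r n' → r ≤ M →
      occ x (window w (q * M + r) (M * suc (suc n'))) ≡
      headCount r (w q) (w (suc q)) + (pairsum β (window w (suc q) (suc n')) + tailCount r (w (suc q + n')) (w (suc (suc q + n'))))
    occ-by-blocks q r n' r≤M = trans (occ-window-head-middle-tail a x' w M q r n' r≤M x'≤M) (cong₂ _+_
      (cong (occ x) (window-inside-twoBlocks q r head-fits))
      (cong₂ _+_ (occ-window-blocks a x' w M w β
                   (λ t → cong (occ x) (window-prefix-twoBlocks t (+-monoʳ-≤ M x'≤M))) (suc q) n')
                 (cong (occ x) (window-prefix-twoBlocks (suc q + n') (+-monoˡ-≤ M r≤M)))))
      where
        head-fits : r + (M ∸ r + ℓ') ≤ M + M
        head-fits = ≤-trans (≤-reflexive (trans (sym (+-assoc r (M ∸ r) ℓ')) (cong (_+ ℓ') (m+[n∸m]≡n r≤M))))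
                            (+-monoʳ-≤ M x'≤M)

  kAbelianEq-by-blocks : ∀ {k} q q' r r' n' → k ∸ 1 ≤ M → r ≤ M →
    r ≡ r' → w q ≡ w q' → w (suc q) ≡ w (suc q') →
    KAbelianEq 2 (factor w (suc q) (suc n')) (factor w (suc q') (suc n')) →
    w (suc q + n') ≡ w (suc q' + n') → w (suc (suc q + n')) ≡ w (suc (suc q' + n')) →
    KAbelianEq k (factor w (q * M + r) (M * suc (suc n'))) (factor w (q' * M + r') (M * suc (suc n')))
  kAbelianEq-by-blocks {k} q q' r .r n' k∸1≤M r≤M refl e₀ e₁ middle≈ e₂ e₃ =
    subst₂ (KAbelianEq k) (sym (factor≡window w (q * M + r) L)) (sym (factor≡window w (q' * M + r) L)) windows≈
    where
      L : ℕ
      L = M * suc (suc n')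
      middle-windows≈ : KAbelianEq 2 (window w (suc q) (suc n')) (window w (suc q') (suc n'))
      middle-windows≈ =
        subst₂ (KAbelianEq 2) (factor≡window w (suc q) (suc n')) (factor≡window w (suc q') (suc n')) middle≈
      windows≈ : KAbelianEq k (window w (q * M + r) L) (window w (q' * M + r) L)
      windows≈ []        ()
      windows≈ (a ∷ x') _ x≤k = begin
        occ x (window w (q * M + r) L)
          ≡⟨ occ-by-blocks q r n' r≤M ⟩
        byBlocks q
          ≡⟨ cong₂ _+_ (cong₂ (headCount r) e₀ e₁)
                       (cong₂ _+_ (pairsum-cong-2Abelian β middle-windows≈) (cong₂ (tailCount r) e₂ e₃)) ⟩
        byBlocks q'
          ≡⟨ occ-by-blocks q' r n' r≤M ⟨
        occ x (window w (q' * M + r) L) ∎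
        where
          open Count a x' (≤-trans (∸-monoˡ-≤ 1 x≤k) k∸1≤M)
          byBlocks : ℕ → ℕ
          byBlocks t = headCount r (w t) (w (suc t)) +
            (pairsum β (window w (suc t) (suc n')) + tailCount r (w (suc t + n')) (w (suc (suc t + n'))))

  complexity-bound : ∀ {k} {{_ : NonZero M}} n' {a b} → k ∸ 1 ≤ M →
    AbelianComplexityIs k w (M * suc (suc n')) a → AbelianComplexityIs 2 w (suc n') b → a ≤ M * s * s * s * s * b
  complexity-bound {k} n' {a} {b} k∸1≤M (ps , distinct , _) (qs , _ , cover) = FinP.injective⇒≤ code-injective
    where
      n : ℕ
      n = suc n'
      L : ℕ
      L = M * suc n

      q : Fin a → ℕ
      q j = DivMod.quotient (ps j divMod M)
      r : Fin a → Fin M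
      r j = DivMod.remainder (ps j divMod M)
      position : ∀ j → ps j ≡ q j * M + toℕ (r j)
      position j = trans (DivMod.property (ps j divMod M)) (+-comm (toℕ (r j)) (q j * M))

      class : ℕ → Fin b
      class t = proj₁ (cover t)
      same-class⇒2Abelian : ∀ {t t'} → class t ≡ class t' → KAbelianEq 2 (factor w t n) (factor w t' n)
      same-class⇒2Abelian {t} {t'} e y 1≤y y≤2 = trans (proj₂ (cover t) y 1≤y y≤2)
        (trans (cong (λ c → occ y (factor w (qs c) n)) e) (sym (proj₂ (cover t') y 1≤y y≤2)))

      code : Fin a → Fin (M * s * s * s * s * b)
      code j = combine (combine (combine (combine (combine (r j) (w (q j))) (w (suc (q j))))
                 (w (suc (q j) + n'))) (w (suc (suc (q j) + n')))) (class (suc (q j)))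

      code-injective : ∀ {j j'} → code j ≡ code j' → j ≡ j'
      code-injective {j} {j'} e
        with FinP.combine-injective _ _ _ _ e
      ... | e₄ , same-class with FinP.combine-injective _ _ _ _ e₄
      ... | e₃ , same-d₁ with FinP.combine-injective _ _ _ _ e₃
      ... | e₂ , same-d₀ with FinP.combine-injective _ _ _ _ e₂
      ... | e₁ , same-c₁ with FinP.combine-injective _ _ _ _ e₁
      ... | same-r , same-c₀ = distinct j j'
        (subst₂ (λ p p' → KAbelianEq k (factor w p L) (factor w p' L)) (sym (position j)) (sym (position j'))
          (kAbelianEq-by-blocks (q j) (q j') (toℕ (r j)) (toℕ (r j')) n' k∸1≤M (<⇒≤ (FinP.toℕ<n (r j)))
             (cong toℕ same-r) same-c₀ same-c₁ (same-class⇒2Abelian same-class) same-d₀ same-d₁))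

lemma2 : ∀ {s : ℕ} (k m : ℕ) → 2 ≤ k → 2 ≤ m →
           (h : UniformMorphism s m) (w : ℕ → Fin s) → IsFixedPoint h w →
           (i : ℕ) → k ∸ 1 ≤ m ^ i →
           ∃₂ λ (C n₀ : ℕ) → ∀ (n : ℕ) → n₀ ≤ n → ∀ (a b : ℕ) →
             AbelianComplexityIs k w (m ^ i * suc n) a →
             AbelianComplexityIs 2 w n b →
             a ≤ C * b
lemma2 k zero _ () h w fixed i k∸1≤M
lemma2 {s} k m@(suc _) _ _ h w fixed i k∸1≤M = m ^ i * s * s * s * s , 1 , bound
  where
    instance
      mⁱ-nonZero : NonZero (m ^ i)
      mⁱ-nonZero = m^n≢0 m i
    open Blocks (iterate h i) w (iterate-fixedPoint fixed i)
    bound : ∀ n → 1 ≤ n → ∀ a b → AbelianComplexityIs k w (m ^ i * suc n) a → AbelianComplexityIs 2 w n b →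
            a ≤ m ^ i * s * s * s * s * b
    bound (suc n') _ a b = complexity-bound n' k∸1≤M
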